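{- For any graph $H$, $\gamma_{tR2}(K_2\vee H)=2$. Conversely, if $G$ is a nontrivial connected graph of order $n$ with $\gamma_{tR2}(G)=2$, then $G\cong K_2\vee H$ for some graph $H$ of order $n-2$.
   Context: All graphs are finite and simple. The join $G\vee H$ of disjoint graphs $G,H$ is obtained from $G$ and $H$ by joining every vertex of $G$ to every vertex of $H$. For $f:V(G)\to\{0,1,2\}$ let $V_i=\{v:f(v)=i\}$; $f$ is a total Roman $\{2\}$-dominating function (TR2DF) if every vertex $v$ with $f(v)=0$ has a neighbor $u$ with $f(u)=2$ or two distinct neighbors $x,y$ with $f(x)=f(y)=1$, and the subgraph induced by $V_1\cup V_2$ has no isolated vertices. $\gamma_{tR2}(G)$ is the minimum weight $\sum_v f(v)$ of a TR2DF of $G$. -}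

module Defs where

open import Data.Nat using (ℕ; zero; suc; _+_; _∸_; _≤_)
open import Data.Fin using (Fin; toℕ; splitAt; _≟_)
open import Data.Bool using (Bool; true; false; not)
open import Data.Sum using (_⊎_; inj₁; inj₂)
open import Data.Product using (Σ; _×_; _,_; ∃)
open import Data.List using (map; allFin)
open import Data.Nat.ListAction using (sum)
open import Relation.Nullary using (¬_; Dec; yes; no)
open import Relation.Binary.PropositionalEquality using (_≡_; _≢_; refl)
import Relation.Binary.PropositionalEquality as ≡
open import Data.Empty using (⊥-elim)
open import Function.Bundles using (_↔_; Inverse)

record Graph (n : ℕ) : Set where
  field
    adj   : Fin n → Fin n → Bool
    sym   : ∀ u v → adj u v ≡ adj v u
    irrefl : ∀ v → adj v v ≡ false
open Graph public

Adj : ∀ {n} → Graph n → Fin n → Fin n → Set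
Adj G u v = adj G u v ≡ true

completeAdj : ∀ {m} → Fin m → Fin m → Bool
completeAdj u v with u ≟ v
... | yes _ = false
... | no _  = true

completeSym : ∀ {m} (u v : Fin m) → completeAdj u v ≡ completeAdj v u
completeSym u v with u ≟ v | v ≟ u
... | yes _ | yes _ = refl
... | no _  | no _  = refl
... | yes p | no q  = ⊥-elim (q (≡.sym p))
... | no p  | yes q = ⊥-elim (p (≡.sym q))

completeIrrefl : ∀ {m} (v : Fin m) → completeAdj v v ≡ false
completeIrrefl v with v ≟ v
... | yes _ = refl
... | no p  = ⊥-elim (p refl)

K : (m : ℕ) → Graph m
K m = record { adj = completeAdj ; sym = completeSym ; irrefl = completeIrrefl }

-- The join of G (on Fin a) and H (on Fin b), on Fin (a + b):
-- the first a vertices are G, the last b vertices are H.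
joinAdj : ∀ {a b} → Graph a → Graph b → Fin (a + b) → Fin (a + b) → Bool
joinAdj {a} G H u v with splitAt a u | splitAt a v
... | inj₁ x | inj₁ y = adj G x y
... | inj₂ x | inj₂ y = adj H x y
... | inj₁ _ | inj₂ _ = true
... | inj₂ _ | inj₁ _ = true

joinSym : ∀ {a b} (G : Graph a) (H : Graph b) (u v : Fin (a + b)) →
          joinAdj G H u v ≡ joinAdj G H v u
joinSym {a} G H u v with splitAt a u | splitAt a v
... | inj₁ x | inj₁ y = sym G x y
... | inj₂ x | inj₂ y = sym H x y
... | inj₁ _ | inj₂ _ = refl
... | inj₂ _ | inj₁ _ = refl

joinIrrefl : ∀ {a b} (G : Graph a) (H : Graph b) (v : Fin (a + b)) →
             joinAdj G H v v ≡ false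
joinIrrefl {a} G H v with splitAt a v
... | inj₁ x = irrefl G x
... | inj₂ x = irrefl H x

_∨G_ : ∀ {a b} → Graph a → Graph b → Graph (a + b)
G ∨G H = record { adj = joinAdj G H ; sym = joinSym G H ; irrefl = joinIrrefl G H }

-- Graph isomorphism: a bijection of vertex sets preserving adjacency
-- (in both directions, since it is an equality of Booleans).
record _≅_ {n m : ℕ} (G : Graph n) (H : Graph m) : Set where
  field
    bij      : Fin n ↔ Fin m
    preserve : ∀ u v → adj H (Inverse.to bij u) (Inverse.to bij v) ≡ adj G u v

data Reach {n} (G : Graph n) : Fin n → Fin n → Set where
  here : ∀ {v} → Reach G v v
  step : ∀ {u w v} → Adj G u w → Reach G w v → Reach G u v

Connected : ∀ {n} → Graph n → Set
Connected G = ∀ u v → Reach G u v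

weight : ∀ {n} → (Fin n → Fin 3) → ℕ
weight {n} f = sum (map (λ v → toℕ (f v)) (allFin n))

IsTR2DF : ∀ {n} → Graph n → (Fin n → Fin 3) → Set
IsTR2DF G f =
  (∀ v → toℕ (f v) ≡ 0 →
     (∃ λ u → Adj G v u × toℕ (f u) ≡ 2)
     ⊎ (∃ λ x → ∃ λ y → x ≢ y × Adj G v x × Adj G v y × toℕ (f x) ≡ 1 × toℕ (f y) ≡ 1))
  × (∀ v → toℕ (f v) ≢ 0 → ∃ λ u → Adj G v u × toℕ (f u) ≢ 0)

γtR2≡ : ∀ {n} → Graph n → ℕ → Set
γtR2≡ G k = (∃ λ f → IsTR2DF G f × weight f ≡ k)
          × (∀ f → IsTR2DF G f → k ≤ weight f)

-- A TR2DF has an edge with both ends positive, so its weight is at least 2,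
-- and on K₂ ∨ H the indicator of the K₂-edge attains 2. Conversely a TR2DF of
-- weight 2 is the indicator of an edge ab. Every other vertex has value 0 and
-- no vertex has value 2, so each other vertex is dominated by two 1-neighbours,
-- necessarily a and b. Hence a and b are adjacent to all vertices, and a
-- permutation moving them to positions 0 and 1 exhibits G as K₂ ∨ (G − a − b).
module Submission where

open import Defs hiding (sym)
open import Data.Nat using (ℕ; _∸_; _≤_)
open import Data.Product using (_×_; ∃)

open import Data.Nat using (suc; _+_; s≤s)
import Data.Nat as ℕ
open import Data.Nat.Properties
  using ( +-0-commutativeMonoid; ≤-trans; ≤-reflexive; m≤m+n; +-mono-≤; +-monoʳ-≤
        ; +-cancelˡ-≤; n≤0⇒n≡0; n≢0⇒n>0; 0≢1+n; module ≤-Reasoning)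
open import Data.Nat.ListAction using (sum)
open import Algebra.Properties.CommutativeMonoid.Sum +-0-commutativeMonoid
  using (sum-remove; sum-replicate-zero) renaming (sum to ∑)
open import Data.Fin using (Fin; suc; toℕ; punchOut; _≟_)
import Data.Fin as Fin
open import Data.Fin.Patterns using (0F; 1F)
open import Data.Fin.Properties using (punchIn-punchOut; punchOut-injective)
open import Data.Fin.Permutation using (Permutation; Permutation′; _⟨$⟩ʳ_; flip; inverseʳ; insert)
import Data.Fin.Permutation as Perm
open import Data.List using (tabulate)
open import Data.List.Properties using (map-tabulate)
open import Data.Product using (Σ; ∃₂; _,_; proj₁; proj₂)
open import Data.Sum using (_⊎_; inj₁; inj₂)
open import Data.Vec.Functional using (removeAt)
open import Function using (_∘_; id)
open import Function.Bundles using (Injection)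
open import Function.Definitions using (Injective)
open import Function.Properties.Inverse using (↔⇒↣)
open import Relation.Nullary using (yes; no; contradiction)
open import Relation.Binary.PropositionalEquality
  using (_≡_; _≢_; refl; sym; trans; cong; cong₂)

sum-tabulate : ∀ {n} (g : Fin n → ℕ) → sum (tabulate g) ≡ ∑ g
sum-tabulate {0}     g = refl
sum-tabulate {suc _} g = cong (g 0F +_) (sum-tabulate (g ∘ suc))

weight≡∑ : ∀ {n} (f : Fin n → Fin 3) → weight f ≡ ∑ (toℕ ∘ f)
weight≡∑ f = trans (cong sum (map-tabulate id (toℕ ∘ f))) (sum-tabulate (toℕ ∘ f))

≤-∑ : ∀ {n} (g : Fin n → ℕ) i → g i ≤ ∑ g
≤-∑ {suc _} g i = begin
  g i                     ≤⟨ m≤m+n (g i) _ ⟩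
  g i + ∑ (removeAt g i)  ≡⟨ sym (sum-remove g) ⟩
  ∑ g                     ∎
  where open ≤-Reasoning

pair-≤-∑ : ∀ {n} (g : Fin n → ℕ) {i j} → i ≢ j → g i + g j ≤ ∑ g
pair-≤-∑ {suc _} g {i} {j} i≢j = begin
  g i + g j                   ≡⟨ cong (λ k → g i + g k) (sym (punchIn-punchOut i≢j)) ⟩
  g i + g′ (punchOut i≢j)     ≤⟨ +-monoʳ-≤ (g i) (≤-∑ g′ _) ⟩
  g i + ∑ g′                  ≡⟨ sym (sum-remove g) ⟩
  ∑ g                         ∎
  where
  open ≤-Reasoning
  g′ : Fin _ → ℕ
  g′ = removeAt g i

triple-≤-∑ : ∀ {n} (g : Fin n → ℕ) {i j k} →
             i ≢ j → i ≢ k → j ≢ k → g i + (g j + g k) ≤ ∑ g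
triple-≤-∑ {suc _} g {i} {j} {k} i≢j i≢k j≢k = begin
  g i + (g j + g k)
    ≡⟨ cong₂ (λ x y → g i + (g x + g y)) (sym (punchIn-punchOut i≢j)) (sym (punchIn-punchOut i≢k)) ⟩
  g i + (g′ (punchOut i≢j) + g′ (punchOut i≢k))
    ≤⟨ +-monoʳ-≤ (g i) (pair-≤-∑ g′ (j≢k ∘ punchOut-injective i≢j i≢k)) ⟩
  g i + ∑ g′
    ≡⟨ sym (sum-remove g) ⟩
  ∑ g
    ∎
  where
  open ≤-Reasoning
  g′ : Fin _ → ℕ
  g′ = removeAt g i

pullback : ∀ {m n} → Graph n → (Fin m → Fin n) → Graph m
pullback G σ = record
  { adj    = λ i j → adj G (σ i) (σ j)
  ; sym    = λ i j → Graph.sym G (σ i) (σ j)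
  ; irrefl = λ i → irrefl G (σ i)
  }

≅-relabel : ∀ {m n} (G : Graph n) (J : Graph m) (π : Permutation m n) →
            (∀ i j → adj J i j ≡ adj G (π ⟨$⟩ʳ i) (π ⟨$⟩ʳ j)) → G ≅ J
≅-relabel G J π J≡G∘π = record
  { bij      = flip π
  ; preserve = λ u v → trans (J≡G∘π _ _) (cong₂ (adj G) (inverseʳ π) (inverseʳ π))
  }

adj-sym : ∀ {n} (G : Graph n) {u v} → Adj G u v → Adj G v u
adj-sym G {u} {v} uv = trans (Graph.sym G v u) uv

Universal : ∀ {n} → Graph n → Fin n → Set
Universal G a = ∀ w → a ≢ w → Adj G a w

adj⇒≢ : ∀ {n} (G : Graph n) {u v} → Adj G u v → u ≢ v
adj⇒≢ G {u} uv refl with trans (sym uv) (irrefl G u)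
... | ()

universal-pullback : ∀ {m n} (G : Graph n) {σ : Fin m → Fin n} → Injective _≡_ _≡_ σ →
                     ∀ {i} → Universal G (σ i) → Universal (pullback G σ) i
universal-pullback G σ-inj univ w i≢w = univ _ (i≢w ∘ σ-inj)

join-of-universal-pair : ∀ {k} (J : Graph (2 + k)) → Universal J 0F → Universal J 1F →
                         ∀ i j → adj (K 2 ∨G pullback J (Fin.suc ∘ Fin.suc)) i j ≡ adj J i j
join-of-universal-pair J _     _     0F            0F            = sym (irrefl J 0F)
join-of-universal-pair J univ₀ _     0F            1F            = sym (univ₀ 1F λ ())
join-of-universal-pair J univ₀ _     0F            (suc (suc _)) = sym (univ₀ _ λ ())
join-of-universal-pair J _     univ₁ 1F            0F            = sym (univ₁ 0F λ ())
join-of-universal-pair J _     _     1F            1F            = sym (irrefl J 1F)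
join-of-universal-pair J _     univ₁ 1F            (suc (suc _)) = sym (univ₁ _ λ ())
join-of-universal-pair J univ₀ _     (suc (suc _)) 0F            = sym (adj-sym J (univ₀ _ λ ()))
join-of-universal-pair J _     univ₁ (suc (suc _)) 1F            = sym (adj-sym J (univ₁ _ λ ()))
join-of-universal-pair J _     _     (suc (suc _)) (suc (suc _)) = refl

-- insert 0F c σ sends 0F to c and suc i to punchIn c (σ ⟨$⟩ʳ i).
permutation-onto-pair : ∀ {k} {a b : Fin (2 + k)} → a ≢ b →
                        Σ (Permutation′ (2 + k)) λ π → π ⟨$⟩ʳ 0F ≡ a × π ⟨$⟩ʳ 1F ≡ b
permutation-onto-pair {a = a} a≢b =
  insert 0F a (insert 0F (punchOut a≢b) Perm.id) , refl , punchIn-punchOut a≢b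

universal-pair⇒join : ∀ {k} (G : Graph (2 + k)) {a b} → a ≢ b → Universal G a → Universal G b →
                      ∃ λ (H : Graph k) → G ≅ (K 2 ∨G H)
universal-pair⇒join G a≢b univ-a univ-b with permutation-onto-pair a≢b
... | π , refl , refl =
  pullback J (Fin.suc ∘ Fin.suc) , ≅-relabel G _ π (join-of-universal-pair J univ₀ univ₁)
  where
  J : Graph (2 + _)
  J = pullback G (π ⟨$⟩ʳ_)

  π-injective : Injective _≡_ _≡_ (π ⟨$⟩ʳ_)
  π-injective = Injection.injective (↔⇒↣ π)

  univ₀ : Universal J 0F
  univ₀ = universal-pullback G π-injective univ-a

  univ₁ : Universal J 1F
  univ₁ = universal-pullback G π-injective univ-b

module _ {n} (G : Graph n) {f : Fin n → Fin 3} (isTR2DF : IsTR2DF G f) where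

  positive-vertex : Fin n → ∃ λ v → toℕ (f v) ≢ 0
  positive-vertex v with toℕ (f v) ℕ.≟ 0
  ... | no fv≢0 = v , fv≢0
  ... | yes fv≡0 with proj₁ isTR2DF v fv≡0
  ...   | inj₁ (u , _ , fu≡2)                   = u , λ fu≡0 → 0≢1+n (trans (sym fu≡0) fu≡2)
  ...   | inj₂ (x , _ , _ , _ , _ , fx≡1 , _) = x , λ fx≡0 → 0≢1+n (trans (sym fx≡0) fx≡1)

  positive-edge : Fin n → ∃₂ λ a b → Adj G a b × toℕ (f a) ≢ 0 × toℕ (f b) ≢ 0
  positive-edge v with positive-vertex v
  ... | a , fa≢0 with proj₂ isTR2DF a fa≢0
  ...   | b , ab , fb≢0 = a , b , ab , fa≢0 , fb≢0

  2≤weight : Fin n → 2 ≤ weight f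
  2≤weight v with positive-edge v
  ... | a , b , ab , fa≢0 , fb≢0 = begin
    2                      ≤⟨ +-mono-≤ (n≢0⇒n>0 fa≢0) (n≢0⇒n>0 fb≢0) ⟩
    toℕ (f a) + toℕ (f b)  ≤⟨ pair-≤-∑ (toℕ ∘ f) (adj⇒≢ G ab) ⟩
    ∑ (toℕ ∘ f)            ≡⟨ sym (weight≡∑ f) ⟩
    weight f               ∎
    where open ≤-Reasoning

positive-summands-≤2⇒≡1 : ∀ {m n} → m ≢ 0 → n ≢ 0 → m + n ≤ 2 → m ≡ 1 × n ≡ 1
positive-summands-≤2⇒≡1 {0}                 m≢0 _   _ = contradiction refl m≢0
positive-summands-≤2⇒≡1 {suc _} {0}         _   n≢0 _ = contradiction refl n≢0
positive-summands-≤2⇒≡1 {1}     {1}         _   _   _ = refl , refl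
positive-summands-≤2⇒≡1 {1}     {suc (suc _)} _ _ (s≤s (s≤s ()))
positive-summands-≤2⇒≡1 {2}     {suc _}       _ _ (s≤s (s≤s ()))
positive-summands-≤2⇒≡1 {suc (suc (suc _))} {suc _} _ _ (s≤s (s≤s ()))

IsPairIndicator : ∀ {n} → (Fin n → Fin 3) → Fin n → Fin n → Set
IsPairIndicator f a b = toℕ (f a) ≡ 1 × toℕ (f b) ≡ 1 × (∀ w → a ≢ w → b ≢ w → toℕ (f w) ≡ 0)

weight-two⇒pair-indicator : ∀ {n} (G : Graph n) {f} → IsTR2DF G f → weight f ≡ 2 → Fin n →
                            ∃₂ λ a b → Adj G a b × IsPairIndicator f a b
weight-two⇒pair-indicator G {f} isTR2DF weight≡2 v with positive-edge G isTR2DF v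
... | a , b , ab , fa≢0 , fb≢0 = a , b , ab , fa≡1 , fb≡1 , off-pair-zero
  where
  open ≤-Reasoning

  value : Fin _ → ℕ
  value = toℕ ∘ f

  a≢b : a ≢ b
  a≢b = adj⇒≢ G ab

  ∑≡2 : ∑ value ≡ 2
  ∑≡2 = trans (sym (weight≡∑ f)) weight≡2

  fa≡1×fb≡1 : value a ≡ 1 × value b ≡ 1
  fa≡1×fb≡1 = positive-summands-≤2⇒≡1 fa≢0 fb≢0 (≤-trans (pair-≤-∑ value a≢b) (≤-reflexive ∑≡2))

  fa≡1 : value a ≡ 1
  fa≡1 = proj₁ fa≡1×fb≡1

  fb≡1 : value b ≡ 1
  fb≡1 = proj₂ fa≡1×fb≡1

  off-pair-zero : ∀ w → a ≢ w → b ≢ w → value w ≡ 0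
  off-pair-zero w a≢w b≢w = n≤0⇒n≡0 (+-cancelˡ-≤ 2 _ 0 (begin
    2 + value w                    ≡⟨ cong₂ (λ x y → x + (y + value w)) (sym fa≡1) (sym fb≡1) ⟩
    value a + (value b + value w)  ≤⟨ triple-≤-∑ value a≢b a≢w b≢w ⟩
    ∑ value                        ≡⟨ ∑≡2 ⟩
    2                              ∎))

pair-indicator⇒universal : ∀ {n} (G : Graph n) {f a b} → IsTR2DF G f → Adj G a b →
                           IsPairIndicator f a b → Universal G a × Universal G b
pair-indicator⇒universal G {f} {a} {b} (dominated , _) ab (fa≡1 , fb≡1 , off-pair-zero) =
  universal-a , universal-b
  where
  one⇒a⊎b : ∀ x → toℕ (f x) ≡ 1 → a ≡ x ⊎ b ≡ x
  one⇒a⊎b x fx≡1 with a ≟ x | b ≟ x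
  ... | yes a≡x | _       = inj₁ a≡x
  ... | no _    | yes b≡x = inj₂ b≡x
  ... | no a≢x  | no b≢x  = contradiction (trans (sym (off-pair-zero x a≢x b≢x)) fx≡1) λ ()

  not-two : ∀ u → toℕ (f u) ≢ 2
  not-two u fu≡2 with a ≟ u | b ≟ u
  ... | yes refl | _        = contradiction (trans (sym fa≡1) fu≡2) λ ()
  ... | no _     | yes refl = contradiction (trans (sym fb≡1) fu≡2) λ ()
  ... | no a≢u   | no b≢u   = contradiction (trans (sym (off-pair-zero u a≢u b≢u)) fu≡2) λ ()

  common-neighbour : ∀ w → a ≢ w → b ≢ w → Adj G a w × Adj G b w
  common-neighbour w a≢w b≢w with dominated w (off-pair-zero w a≢w b≢w)
  ... | inj₁ (u , _ , fu≡2) = contradiction fu≡2 (not-two u)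
  ... | inj₂ (x , y , x≢y , wx , wy , fx≡1 , fy≡1) with one⇒a⊎b x fx≡1 | one⇒a⊎b y fy≡1
  ...   | inj₁ refl | inj₁ refl = contradiction refl x≢y
  ...   | inj₁ refl | inj₂ refl = adj-sym G wx , adj-sym G wy
  ...   | inj₂ refl | inj₁ refl = adj-sym G wy , adj-sym G wx
  ...   | inj₂ refl | inj₂ refl = contradiction refl x≢y

  universal-a : Universal G a
  universal-a w a≢w with b ≟ w
  ... | yes refl = ab
  ... | no b≢w   = proj₁ (common-neighbour w a≢w b≢w)

  universal-b : Universal G b
  universal-b w b≢w with a ≟ w
  ... | yes refl = adj-sym G ab
  ... | no a≢w   = proj₂ (common-neighbour w a≢w b≢w)

weight-two-TR2DF⇒join : ∀ {k} (G : Graph (2 + k)) {f} → IsTR2DF G f → weight f ≡ 2 →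
                        ∃ λ (H : Graph k) → G ≅ (K 2 ∨G H)
weight-two-TR2DF⇒join G isTR2DF weight≡2 with weight-two⇒pair-indicator G isTR2DF weight≡2 0F
... | a , b , ab , indicator with pair-indicator⇒universal G isTR2DF ab indicator
...   | univ-a , univ-b = universal-pair⇒join G (adj⇒≢ G ab) univ-a univ-b

onesOnK2 : ∀ {m} → Fin (2 + m) → Fin 3
onesOnK2 0F            = 1F
onesOnK2 1F            = 1F
onesOnK2 (suc (suc _)) = 0F

onesOnK2-isTR2DF : ∀ {m} (H : Graph m) → IsTR2DF (K 2 ∨G H) onesOnK2
onesOnK2-isTR2DF H = dominated , total
  where
  G : Graph _
  G = K 2 ∨G H

  dominated : ∀ v → toℕ (onesOnK2 v) ≡ 0 →
              (∃ λ u → Adj G v u × toℕ (onesOnK2 u) ≡ 2)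
              ⊎ (∃₂ λ x y → x ≢ y × Adj G v x × Adj G v y
                            × toℕ (onesOnK2 x) ≡ 1 × toℕ (onesOnK2 y) ≡ 1)
  dominated (suc (suc _)) _ = inj₂ (0F , 1F , (λ ()) , refl , refl , refl , refl)

  total : ∀ v → toℕ (onesOnK2 v) ≢ 0 → ∃ λ u → Adj G v u × toℕ (onesOnK2 u) ≢ 0
  total 0F            _   = 1F , refl , λ ()
  total 1F            _   = 0F , refl , λ ()
  total (suc (suc _)) f≢0 = contradiction refl f≢0

weight-onesOnK2 : ∀ m → weight (onesOnK2 {m}) ≡ 2
weight-onesOnK2 m = trans (weight≡∑ (onesOnK2 {m})) (cong (2 +_) (sum-replicate-zero m))

γtR2-K2∨H : ∀ {m} (H : Graph m) → γtR2≡ (K 2 ∨G H) 2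
γtR2-K2∨H {m} H =
  (onesOnK2 , onesOnK2-isTR2DF H , weight-onesOnK2 m) , λ _ isTR2DF → 2≤weight (K 2 ∨G H) isTR2DF 0F

γtR2≡2⇒join : ∀ {n} (G : Graph n) → 2 ≤ n → γtR2≡ G 2 →
              ∃ λ (H : Graph (n ∸ 2)) → G ≅ (K 2 ∨G H)
γtR2≡2⇒join G (s≤s (s≤s _)) ((_ , isTR2DF , weight≡2) , _) =
  weight-two-TR2DF⇒join G isTR2DF weight≡2

mainTheorem10 : (∀ {m} (H : Graph m) → γtR2≡ (K 2 ∨G H) 2)
    × (∀ {n} (G : Graph n) → 2 ≤ n → Connected G → γtR2≡ G 2 →
    ∃ λ (H : Graph (n ∸ 2)) → G ≅ (K 2 ∨G H))
mainTheorem10 = γtR2-K2∨H , λ G 2≤n _ → γtR2≡2⇒join G 2≤n
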